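{- Let $p$ be a prime and let $A\subseteq\mathbb{Z}/p\mathbb{Z}$ be sum-free, and write $n:=|A|$. If $[-(p-n+1)/3,(p-n+1)/3]_p\cap A=\varnothing$, then $A\subseteq[n,p-n]_p$.
   Context: A subset $A$ of an additively written abelian group is sum-free if there are no $a_1,a_2,a_3\in A$ (not necessarily distinct) with $a_1+a_2=a_3$. Let $\phi_p:\mathbb{Z}\to\mathbb{Z}/p\mathbb{Z}$ be the canonical homomorphism; for a real interval $I$, $I_p$ denotes $\phi_p(I\cap\mathbb{Z})$; e.g. $[-(p-n+1)/3,(p-n+1)/3]_p$ is the image of the set of integers $z$ with $|z|\le (p-n+1)/3$, and $[n,p-n]_p$ is the image of the integers $z$ with $n\le z\le p-n$. -}

module Defs where

open import Data.Nat as ℕ using (ℕ; NonZero; _∸_; _≤_)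
open import Data.Nat.DivMod using (_mod_)
open import Data.Fin using (Fin; toℕ)
open import Data.Fin.Subset using (Subset; _∈_; _∉_)
open import Data.Integer as ℤ using (ℤ; +_; ∣_∣)
open import Data.Integer.DivMod using (_%ℕ_)
open import Data.Product using (∃; _×_)
open import Relation.Binary.PropositionalEquality using (_≡_)

-- ℤ/pℤ is modelled as Fin p (canonical residues 0,…,p-1).

addMod : (p : ℕ) .{{_ : NonZero p}} → Fin p → Fin p → Fin p
addMod p x y = (toℕ x ℕ.+ toℕ y) mod p

IsImage : (p : ℕ) .{{_ : NonZero p}} → ℤ → Fin p → Set
IsImage p z x = toℕ x ≡ z %ℕ p

SumFree : (p : ℕ) .{{_ : NonZero p}} → Subset p → Set
SumFree p A = ∀ a₁ a₂ a₃ → a₁ ∈ A → a₂ ∈ A → a₃ ∈ A → addMod p a₁ a₂ ≡ a₃ → Data.Empty.⊥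
  where import Data.Empty

Image : (p : ℕ) .{{_ : NonZero p}} → (ℤ → Set) → Fin p → Set
Image p I x = ∃ λ z → I z × IsImage p z x

-- integers z with |z| ≤ (p-n+1)/3, i.e. 3|z| ≤ p-n+1
SymInt : ℕ → ℕ → ℤ → Set
SymInt p n z = (+ 3) ℤ.* (+ ∣ z ∣) ℤ.≤ (+ p) ℤ.- (+ n) ℤ.+ (+ 1)

MidInt : ℕ → ℕ → ℤ → Set
MidInt p n z = (+ n) ℤ.≤ z × z ℤ.≤ (+ p) ℤ.- (+ n)

-- Let T = ⌊(p - n + 1)/3⌋. The hypothesis puts every element of A strictly between T and p - T,
-- i.e. in a window of length L = p - 2T - 1 of consecutive residues. For x ∈ A, sum-freeness says
-- that no two elements of A differ by a = x, nor by a = p - x (read cyclically). A set in a window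
-- of length L with no two elements at distance a has at most max(a, L - a) elements, by pairing
-- i with i + a. Since a > T, the bound L - a is smaller than n, so n ≤ a for both choices of a,
-- which is n ≤ x ≤ p - n.
module Submission where

open import Defs
open import Data.Fin using (Fin; toℕ; zero; suc)
open import Data.Fin.Properties using (toℕ<n; toℕ-injective; toℕ-fromℕ<)
open import Data.Fin.Subset using (Subset; _∈_; ∣_∣; inside; outside)
open import Data.Fin.Subset.Properties using (∣p∣≤n)
open import Data.Integer as ℤ using (ℤ; -[1+_]; +≤+) renaming (+_ to pos)
open import Data.Integer.Properties using ([+m]-[+n]≡m⊖n; ⊖-≥; pos-*)
open import Data.Nat
open import Data.Nat.DivMod
open import Data.Nat.Primality using (Prime)
open import Data.Nat.Properties
open import Data.Nat.Tactic.RingSolver using (solve-∀)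
open import Algebra.Properties.CommutativeSemigroup +-commutativeSemigroup
  using (interchange; xy∙z≈xz∙y)
open import Data.Product using (∃; _×_; _,_; proj₁; proj₂)
open import Data.Sum using (_⊎_; inj₁; inj₂; fromInj₁)
open import Data.Vec.Base using (_∷_; []; here; there)
open import Function using (_∘_)
open import Relation.Binary.PropositionalEquality
open import Relation.Nullary using (¬_; yes; no; contradiction)

sumFrom : (ℕ → ℕ) → ℕ → ℕ → ℕ
sumFrom f s zero    = 0
sumFrom f s (suc k) = f s + sumFrom f (suc s) k

sumFrom-suc : ∀ f s k → sumFrom f (suc s) k ≡ sumFrom (f ∘ suc) s k
sumFrom-suc f s zero    = refl
sumFrom-suc f s (suc k) = cong (f (suc s) +_) (sumFrom-suc f (suc s) k)

sumFrom-+ : ∀ f s k l → sumFrom f s (k + l) ≡ sumFrom f s k + sumFrom f (s + k) l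
sumFrom-+ f s zero    l = cong (λ t → sumFrom f t l) (sym (+-identityʳ s))
sumFrom-+ f s (suc k) l = begin
  f s + sumFrom f (suc s) (k + l)                           ≡⟨ cong (f s +_) (sumFrom-+ f (suc s) k l) ⟩
  f s + (sumFrom f (suc s) k + sumFrom f (suc s + k) l)     ≡⟨ cong (λ t → f s + (sumFrom f (suc s) k + sumFrom f t l)) (sym (+-suc s k)) ⟩
  f s + (sumFrom f (suc s) k + sumFrom f (s + suc k) l)     ≡⟨ sym (+-assoc (f s) _ _) ⟩
  f s + sumFrom f (suc s) k + sumFrom f (s + suc k) l       ∎
  where open ≡-Reasoning

sumFrom-≤ : ∀ f s k → (∀ i → f i ≤ 1) → sumFrom f s k ≤ k
sumFrom-≤ f s zero    f≤1 = z≤n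
sumFrom-≤ f s (suc k) f≤1 = +-mono-≤ (f≤1 s) (sumFrom-≤ f (suc s) k f≤1)

sumFrom-≡0 : ∀ f s k → (∀ i → s ≤ i → i < s + k → f i ≡ 0) → sumFrom f s k ≡ 0
sumFrom-≡0 f s zero    f≡0 = refl
sumFrom-≡0 f s (suc k) f≡0 = cong₂ _+_ (f≡0 s ≤-refl (m<m+n s z<s))
  (sumFrom-≡0 f (suc s) k λ i s<i i<s+k → f≡0 i (<⇒≤ s<i) (subst (i <_) (sym (+-suc s k)) i<s+k))

sumFrom-shiftPair : ∀ f a s k → (∀ i → f i + f (i + a) ≤ 1) → sumFrom f s k + sumFrom f (s + a) k ≤ k
sumFrom-shiftPair f a s zero    pair = z≤n
sumFrom-shiftPair f a s (suc k) pair = begin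
  (f s + sumFrom f (suc s) k) + (f (s + a) + sumFrom f (suc s + a) k)
    ≡⟨ interchange (f s) _ (f (s + a)) _ ⟩
  (f s + f (s + a)) + (sumFrom f (suc s) k + sumFrom f (suc s + a) k)
    ≤⟨ +-mono-≤ (pair s) (sumFrom-shiftPair f a (suc s) k pair) ⟩
  suc k ∎
  where open ≤-Reasoning

-- Split the window as [a][a][rest] when L = a + b with a ≤ b, and as [b][a - b][b] when b < a;
-- the two paired blocks together carry at most their common length.
sumFrom-avoidingShift : ∀ f a s L → (∀ i → f i ≤ 1) → (∀ i → f i + f (i + a) ≤ 1)
                      → sumFrom f s L ≤ a ⊎ sumFrom f s L + a ≤ L
sumFrom-avoidingShift f a s L f≤1 pair with L ≤? a
... | yes L≤a = inj₁ (≤-trans (sumFrom-≤ f s L f≤1) L≤a)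
... | no L≰a with m≤n⇒∃[o]m+o≡n (≰⇒≥ L≰a)
... | b , refl with a ≤? b
... | yes a≤b = inj₂ (≤-trans (+-monoˡ-≤ a (two-blocks a≤b)) (≤-reflexive (+-comm b a)))
  where
  two-blocks : a ≤ b → sumFrom f s (a + b) ≤ b
  two-blocks a≤b with m≤n⇒∃[o]m+o≡n a≤b
  ... | e , refl = begin
    sumFrom f s (a + (a + e))                                          ≡⟨ sumFrom-+ f s a (a + e) ⟩
    sumFrom f s a + sumFrom f (s + a) (a + e)                          ≡⟨ cong (sumFrom f s a +_) (sumFrom-+ f (s + a) a e) ⟩
    sumFrom f s a + (sumFrom f (s + a) a + sumFrom f (s + a + a) e)    ≡⟨ sym (+-assoc (sumFrom f s a) _ _) ⟩
    (sumFrom f s a + sumFrom f (s + a) a) + sumFrom f (s + a + a) e    ≤⟨ +-mono-≤ (sumFrom-shiftPair f a s a pair) (sumFrom-≤ f _ e f≤1) ⟩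
    a + e                                                              ∎
    where open ≤-Reasoning
... | no a≰b with m≤n⇒∃[o]m+o≡n (≰⇒≥ a≰b)
... | e , refl = inj₁ (begin
    sumFrom f s ((b + e) + b)                                            ≡⟨ sumFrom-+ f s (b + e) b ⟩
    sumFrom f s (b + e) + sumFrom f (s + (b + e)) b                      ≡⟨ cong (_+ sumFrom f (s + (b + e)) b) (sumFrom-+ f s b e) ⟩
    (sumFrom f s b + sumFrom f (s + b) e) + sumFrom f (s + (b + e)) b    ≡⟨ xy∙z≈xz∙y (sumFrom f s b) _ _ ⟩
    (sumFrom f s b + sumFrom f (s + (b + e)) b) + sumFrom f (s + b) e    ≤⟨ +-mono-≤ (sumFrom-shiftPair f (b + e) s b pair) (sumFrom-≤ f _ e f≤1) ⟩
    b + e                                                                ∎)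
  where open ≤-Reasoning

indicator : ∀ {m} → Subset m → ℕ → ℕ
indicator []            i       = 0
indicator (_ ∷ v)       (suc i) = indicator v i
indicator (inside  ∷ v) zero    = 1
indicator (outside ∷ v) zero    = 0

indicator-≤1 : ∀ {m} (v : Subset m) i → indicator v i ≤ 1
indicator-≤1 []            i       = z≤n
indicator-≤1 (_ ∷ v)       (suc i) = indicator-≤1 v i
indicator-≤1 (inside  ∷ v) zero    = ≤-refl
indicator-≤1 (outside ∷ v) zero    = z≤n

indicator-view : ∀ {m} (v : Subset m) i → indicator v i ≡ 0 ⊎ ∃ λ x → x ∈ v × toℕ x ≡ i
indicator-view []            i       = inj₁ refl
indicator-view (inside  ∷ v) zero    = inj₂ (zero , here , refl)
indicator-view (outside ∷ v) zero    = inj₁ refl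
indicator-view (_ ∷ v)       (suc i) with indicator-view v i
... | inj₁ ≡0              = inj₁ ≡0
... | inj₂ (x , x∈v , x≡i) = inj₂ (suc x , there x∈v , cong suc x≡i)

indicator-≡0 : ∀ {m} (v : Subset m) i → (∀ x → x ∈ v → toℕ x ≢ i) → indicator v i ≡ 0
indicator-≡0 v i ∉v with indicator-view v i
... | inj₁ ≡0              = ≡0
... | inj₂ (x , x∈v , x≡i) = contradiction x≡i (∉v x x∈v)

AvoidsShift : ∀ {m} → Subset m → ℕ → Set
AvoidsShift v a = ∀ x y → x ∈ v → y ∈ v → toℕ y ≢ toℕ x + a

indicator-avoidingShift : ∀ {m} (v : Subset m) a → AvoidsShift v a
                        → ∀ i → indicator v i + indicator v (i + a) ≤ 1
indicator-avoidingShift v a avoid i with indicator-view v i | indicator-view v (i + a)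
... | inj₁ ≡0 | _ rewrite ≡0 = indicator-≤1 v (i + a)
... | _ | inj₁ ≡0 rewrite ≡0 | +-identityʳ (indicator v i) = indicator-≤1 v i
... | inj₂ (x , x∈v , refl) | inj₂ (y , y∈v , y≡x+a) = contradiction y≡x+a (avoid x y x∈v y∈v)

∣v∣≡sumFrom : ∀ {m} (v : Subset m) → ∣ v ∣ ≡ sumFrom (indicator v) 0 m
∣v∣≡sumFrom {suc m} (inside  ∷ v) = cong suc (trans (∣v∣≡sumFrom v) (sym (sumFrom-suc (indicator (inside ∷ v)) 0 m)))
∣v∣≡sumFrom {suc m} (outside ∷ v) = trans (∣v∣≡sumFrom v) (sym (sumFrom-suc (indicator (outside ∷ v)) 0 m))
∣v∣≡sumFrom {zero}  []            = refl

InWindow : ∀ {m} → Subset m → ℕ → ℕ → Set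
InWindow v s L = ∀ x → x ∈ v → s ≤ toℕ x × toℕ x < s + L

∣v∣≡sumFrom-window : ∀ {m} (v : Subset m) s L → s + L ≤ m → InWindow v s L
                   → ∣ v ∣ ≡ sumFrom (indicator v) s L
∣v∣≡sumFrom-window {m} v s L s+L≤m inWindow with m≤n⇒∃[o]m+o≡n s+L≤m
... | r , refl = begin
  ∣ v ∣                                                    ≡⟨ ∣v∣≡sumFrom v ⟩
  sumFrom c 0 (s + L + r)                                  ≡⟨ sumFrom-+ c 0 (s + L) r ⟩
  sumFrom c 0 (s + L) + sumFrom c (s + L) r                ≡⟨ cong₂ _+_ (sumFrom-+ c 0 s L) after ⟩
  (sumFrom c 0 s + sumFrom c s L) + 0                      ≡⟨ cong (λ t → t + sumFrom c s L + 0) before ⟩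
  sumFrom c s L + 0                                        ≡⟨ +-identityʳ _ ⟩
  sumFrom c s L                                            ∎
  where
  open ≡-Reasoning
  c : ℕ → ℕ
  c = indicator v
  before : sumFrom c 0 s ≡ 0
  before = sumFrom-≡0 c 0 s λ i _ i<s → indicator-≡0 v i λ x x∈v x≡i →
    <⇒≱ i<s (subst (s ≤_) x≡i (proj₁ (inWindow x x∈v)))
  after : sumFrom c (s + L) r ≡ 0
  after = sumFrom-≡0 c (s + L) r λ i s+L≤i _ → indicator-≡0 v i λ x x∈v x≡i →
    <⇒≱ (subst (_< s + L) x≡i (proj₂ (inWindow x x∈v))) s+L≤i

∣v∣-avoidingShift : ∀ {m} (v : Subset m) a s L → s + L ≤ m → InWindow v s L → AvoidsShift v a
                  → ∣ v ∣ ≤ a ⊎ ∣ v ∣ + a ≤ L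
∣v∣-avoidingShift v a s L s+L≤m inWindow avoid
  rewrite ∣v∣≡sumFrom-window v s L s+L≤m inWindow =
  sumFrom-avoidingShift (indicator v) a s L (indicator-≤1 v) (indicator-avoidingShift v a avoid)

window-too-short : ∀ {m n T L a} → n ≤ m → m ∸ n + 1 ≤ 2 + 3 * T → suc T + L + T ≡ m → T < a
                 → n + a ≰ L
window-too-short {m} {n} {T} {L} {a} n≤m budget m≡ T<a n+a≤L = n≮n (2 + 3 * T + n) (begin-strict
  2 + 3 * T + n                    <⟨ n<1+n _ ⟩
  3 + 3 * T + n                    ≡⟨ rearrange T n ⟩
  suc (suc T + (n + suc T) + T)    ≤⟨ s≤s (+-monoˡ-≤ T (+-monoʳ-≤ (suc T) (≤-trans (+-monoʳ-≤ n T<a) n+a≤L))) ⟩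
  suc (suc T + L + T)              ≡⟨ cong suc m≡ ⟩
  suc m                            ≡⟨ +-comm 1 m ⟩
  m + 1                            ≡⟨ cong (_+ 1) (sym (m∸n+n≡m n≤m)) ⟩
  m ∸ n + n + 1                    ≡⟨ xy∙z≈xz∙y (m ∸ n) n 1 ⟩
  m ∸ n + 1 + n                    ≤⟨ +-monoˡ-≤ n budget ⟩
  2 + 3 * T + n                    ∎)
  where
  open ≤-Reasoning
  rearrange : ∀ T n → 3 + 3 * T + n ≡ suc (suc T + (n + suc T) + T)
  rearrange = solve-∀

-- The window is [T + 1, m - T); if the second alternative of ∣v∣-avoidingShift held, the window
-- would be longer than m - n + 1 ≤ 3T + 2 permits.
∣v∣≤avoidedShift : ∀ {m T a} (v : Subset m) → m ∸ ∣ v ∣ + 1 ≤ 2 + 3 * T → suc T + T ≤ m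
                 → (∀ y → y ∈ v → T < toℕ y × toℕ y + T < m) → T < a → AvoidsShift v a
                 → ∣ v ∣ ≤ a
∣v∣≤avoidedShift {m} {T} {a} v budget 2T+1≤m between T<a avoids =
  fromInj₁ (λ n+a≤L → contradiction n+a≤L (window-too-short (∣p∣≤n v) budget m≡ T<a))
    (∣v∣-avoidingShift v a (suc T) L (subst (suc T + L ≤_) m≡ (m≤m+n _ T)) inWindow avoids)
  where
  L : ℕ
  L = proj₁ (m≤n⇒∃[o]m+o≡n 2T+1≤m)
  m≡ : suc T + L + T ≡ m
  m≡ = trans (sym (xy∙z≈xz∙y (suc T) T L)) (proj₂ (m≤n⇒∃[o]m+o≡n 2T+1≤m))
  inWindow : InWindow v (suc T) L
  inWindow y y∈v = proj₁ (between y y∈v)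
                 , +-cancelʳ-< T _ _ (subst (toℕ y + T <_) (sym m≡) (proj₂ (between y y∈v)))

3*[m/3]≤m : ∀ m → 3 * (m / 3) ≤ m
3*[m/3]≤m m = subst (_≤ m) (*-comm (m / 3) 3) (m/n*n≤m m 3)

m≤2+3*[m/3] : ∀ m → m ≤ 2 + 3 * (m / 3)
m≤2+3*[m/3] m = begin
  m                     ≡⟨ m≡m%n+[m/n]*n m 3 ⟩
  m % 3 + m / 3 * 3     ≤⟨ +-mono-≤ (≤-pred (m%n<n m 3)) (≤-reflexive (*-comm (m / 3) 3)) ⟩
  2 + 3 * (m / 3)       ∎
  where open ≤-Reasoning

module _ {p : ℕ} .{{_ : NonZero p}} where

  isImage-pos : (x : Fin p) → IsImage p (pos (toℕ x)) x
  isImage-pos x = sym (m<n⇒m%n≡m (toℕ<n x))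

  isImage-neg : ∀ k (x : Fin p) → suc k < p → toℕ x + suc k ≡ p → IsImage p -[1+ k ] x
  isImage-neg k x k<p x+k≡p rewrite m<n⇒m%n≡m k<p =
    trans (sym (m+n∸n≡m (toℕ x) (suc k))) (cong (_∸ suc k) x+k≡p)

  addMod-≡ : ∀ x y z → (toℕ x + toℕ y) % p ≡ toℕ z → addMod p x y ≡ z
  addMod-≡ x y z eq = toℕ-injective (trans (toℕ-fromℕ< (m%n<n _ p)) eq)

  module _ {A : Subset p} (sumFree : SumFree p A) {x : Fin p} (x∈A : x ∈ A) where

    sumFree-avoids : AvoidsShift A (toℕ x)
    sumFree-avoids y z y∈A z∈A z≡y+x = sumFree y x z y∈A x∈A z∈A (addMod-≡ y x z (begin
      (toℕ y + toℕ x) % p    ≡⟨ cong (_% p) (sym z≡y+x) ⟩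
      toℕ z % p              ≡⟨ m<n⇒m%n≡m (toℕ<n z) ⟩
      toℕ z                  ∎))
      where open ≡-Reasoning

    sumFree-avoids-neg : AvoidsShift A (p ∸ toℕ x)
    sumFree-avoids-neg y z y∈A z∈A z≡y+p-x = sumFree z x y z∈A x∈A y∈A (addMod-≡ z x y (begin
      (toℕ z + toℕ x) % p                ≡⟨ cong (λ t → (t + toℕ x) % p) z≡y+p-x ⟩
      (toℕ y + (p ∸ toℕ x) + toℕ x) % p  ≡⟨ cong (_% p) (+-assoc (toℕ y) _ _) ⟩
      (toℕ y + (p ∸ toℕ x + toℕ x)) % p  ≡⟨ cong (λ t → (toℕ y + t) % p) (m∸n+n≡m (<⇒≤ (toℕ<n x))) ⟩
      (toℕ y + p) % p                    ≡⟨ [m+n]%n≡m%n (toℕ y) p ⟩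
      toℕ y % p                          ≡⟨ m<n⇒m%n≡m (toℕ<n y) ⟩
      toℕ y                              ∎))
      where open ≡-Reasoning

  module _ {n : ℕ} (n≤p : n ≤ p) where

    symInt : ∀ z → 3 * ℤ.∣ z ∣ ≤ p ∸ n + 1 → SymInt p n z
    symInt z small = subst₂ ℤ._≤_ (pos-* 3 ℤ.∣ z ∣) (sym p-n+1≡) (+≤+ small)
      where
      p-n+1≡ : pos p ℤ.- pos n ℤ.+ pos 1 ≡ pos (p ∸ n + 1)
      p-n+1≡ = cong (ℤ._+ pos 1) (trans ([+m]-[+n]≡m⊖n p n) (⊖-≥ n≤p))

    image-symInt-pos : (y : Fin p) → 3 * toℕ y ≤ p ∸ n + 1 → Image p (SymInt p n) y
    image-symInt-pos y small = pos (toℕ y) , symInt (pos (toℕ y)) small , isImage-pos y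

    image-symInt-neg : (y : Fin p) → 0 < toℕ y → 3 * (p ∸ toℕ y) ≤ p ∸ n + 1
                     → Image p (SymInt p n) y
    image-symInt-neg y 0<y small with p ∸ toℕ y in p-y≡
    ... | zero  = contradiction (m∸n≡0⇒m≤n p-y≡) (<⇒≱ (toℕ<n y))
    ... | suc k = -[1+ k ] , symInt -[1+ k ] small , isImage-neg k y k<p y+k≡p
      where
      k<p : suc k < p
      k<p = subst (_< p) p-y≡ (∸-monoʳ-< 0<y (<⇒≤ (toℕ<n y)))
      y+k≡p : toℕ y + suc k ≡ p
      y+k≡p = trans (cong (toℕ y +_) (sym p-y≡)) (m+[n∸m]≡n (<⇒≤ (toℕ<n y)))

    symInt-free⇒between : ∀ {A : Subset p} {T} → 3 * T ≤ p ∸ n + 1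
                        → (∀ y → y ∈ A → ¬ Image p (SymInt p n) y)
                        → ∀ y → y ∈ A → T < toℕ y × toℕ y + T < p
    symInt-free⇒between {T = T} 3T≤ free y y∈A = T<y , y+T<p
      where
      T<y : T < toℕ y
      T<y = ≰⇒> λ y≤T → free y y∈A (image-symInt-pos y (≤-trans (*-monoʳ-≤ 3 y≤T) 3T≤))
      y+T<p : toℕ y + T < p
      y+T<p = ≰⇒> λ p≤y+T → free y y∈A (image-symInt-neg y (≤-trans z<s T<y)
        (≤-trans (*-monoʳ-≤ 3 (m≤n+o⇒m∸n≤o p (toℕ y) p≤y+T)) 3T≤))

    midInt : ∀ m → m ≤ p → n ≤ m → n ≤ p ∸ m → MidInt p n (pos m)
    midInt m m≤p n≤m n≤p-m = +≤+ n≤m , subst (pos m ℤ.≤_) (sym p-n≡) (+≤+ m≤p-n)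
      where
      p-n≡ : pos p ℤ.- pos n ≡ pos (p ∸ n)
      p-n≡ = trans ([+m]-[+n]≡m⊖n p n) (⊖-≥ n≤p)
      m≤p-n : m ≤ p ∸ n
      m≤p-n = m+n≤o⇒m≤o∸n m (subst (_≤ p) (+-comm n m) (m≤o∸n⇒m+n≤o n m≤p n≤p-m))

lemma7 : (p : ℕ) .{{_ : NonZero p}} → Prime p → (A : Subset p) → SumFree p A
       → (∀ x → x ∈ A → ¬ Image p (SymInt p ∣ A ∣) x)
       → ∀ x → x ∈ A → Image p (MidInt p ∣ A ∣) x
lemma7 p _ A sumFree symInt-free x x∈A =
  pos (toℕ x) , midInt n≤p (toℕ x) (<⇒≤ (toℕ<n x)) n≤x n≤p-x , isImage-pos x
  where
  n : ℕ
  n = ∣ A ∣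
  n≤p : n ≤ p
  n≤p = ∣p∣≤n A
  T : ℕ
  T = (p ∸ n + 1) / 3
  between : ∀ y → y ∈ A → T < toℕ y × toℕ y + T < p
  between = symInt-free⇒between n≤p (3*[m/3]≤m (p ∸ n + 1)) symInt-free
  T<x : T < toℕ x
  T<x = proj₁ (between x x∈A)
  x+T<p : toℕ x + T < p
  x+T<p = proj₂ (between x x∈A)
  n≤avoidedShift : ∀ a → T < a → AvoidsShift A a → n ≤ a
  n≤avoidedShift a = ∣v∣≤avoidedShift A (m≤2+3*[m/3] (p ∸ n + 1))
    (≤-trans (+-monoˡ-≤ T T<x) (<⇒≤ x+T<p)) between
  n≤x : n ≤ toℕ x
  n≤x = n≤avoidedShift (toℕ x) T<x (sumFree-avoids sumFree x∈A)
  n≤p-x : n ≤ p ∸ toℕ x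
  n≤p-x = n≤avoidedShift (p ∸ toℕ x) (m+n≤o⇒m≤o∸n (suc T) (subst (_≤ p) (cong suc (+-comm (toℕ x) T)) x+T<p))
    (sumFree-avoids-neg sumFree x∈A)
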